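{- For any $d>0$ and all sufficiently large $t$, there exists a set $\mathcal{T} \subseteq \mathbb{R}^{d\times(d-1)}$ of matrices with integer entries in $[-t,t]$ such that $|\mathcal{T}| = t^{\Omega(d^2)}$ and (1) every $T \in \mathcal{T}$ has rank $d-1$; (2) for any $S, T \in \mathcal{T}$ with $S \ne T$, the columns of the $d\times(2d-2)$ matrix $[S~T]$ span $\mathbb{R}^d$. -}

module Defs where

open import Data.Nat as ℕ using (ℕ; zero; suc)
open import Data.Fin using (Fin; zero; suc)
open import Data.Integer as ℤ using (ℤ)
open import Data.Rational as ℚ using (ℚ; _+_; _*_; _/_)
open import Data.Vec using (Vec; lookup; _++_; zipWith)
open import Data.Product using (Σ; ∃; _×_)
open import Function.Definitions using (Injective)
open import Relation.Binary.PropositionalEquality using (_≡_)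
open import Relation.Nullary using (¬_)

Mat : ℕ → ℕ → Set
Mat n m = Vec (Vec ℤ m) n

entry : ∀ {n m} → Mat n m → Fin n → Fin m → ℚ
entry M i j = ℚ._/_ (lookup (lookup M i) j) 1

Σℚ : ∀ k → (Fin k → ℚ) → ℚ
Σℚ zero    f = ℚ.0ℚ
Σℚ (suc k) f = f zero + Σℚ k (λ j → f (suc j))

[_∣_] : ∀ {n m k} → Mat n m → Mat n k → Mat n (m ℕ.+ k)
[ S ∣ T ] = zipWith _++_ S T

-- A family of columns c : Fin r → Fin m of M is linearly independent
-- (over ℚ, equivalently over ℝ since the entries are integers).
IndependentCols : ∀ {n m r} → Mat n m → (Fin r → Fin m) → Set
IndependentCols {n} {m} {r} M c =
  (a : Fin r → ℚ) →
  (∀ i → Σℚ r (λ j → a j * entry M i (c j)) ≡ ℚ.0ℚ) →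
  ∀ j → a j ≡ ℚ.0ℚ

RankAtLeast : ∀ {n m} → Mat n m → ℕ → Set
RankAtLeast {n} {m} M r =
  Σ (Fin r → Fin m) λ c → Injective _≡_ _≡_ c × IndependentCols M c

HasRank : ∀ {n m} → Mat n m → ℕ → Set
HasRank M r = RankAtLeast M r × ¬ RankAtLeast M (suc r)

-- The columns of M span ℚ^n (equivalently ℝ^n, as the entries are integers).
ColumnsSpan : ∀ {n m} → Mat n m → Set
ColumnsSpan {n} {m} M =
  (v : Fin n → ℚ) → ∃ λ (a : Fin m → ℚ) →
    ∀ i → Σℚ m (λ j → a j * entry M i j) ≡ v i

EntriesBounded : ∀ {n m} → ℕ → Mat n m → Set
EntriesBounded {n} {m} t M = ∀ (i : Fin n) (j : Fin m) → ℤ.∣ lookup (lookup M i) j ∣ ℕ.≤ t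

module Submission where

-- Split d = m + k with m ≈ k ≈ d/2, write z₀ … z_{m−1} ("places") and x₁ … x_k ("slots") for the
-- standard basis of ℚ^d, and take k numbers N₁ … N_k < t^m with base-t digits c_{il}.  The matrix
-- T_N has the m − 1 "carry" columns z_{l+1} − t z_l and the k "number" columns x_i − Σ_l c_{il} z_l,
-- all with entries in [−t, t].  Its columns are independent: the x-rows kill the coefficients of
-- the number columns, and the z-rows then kill those of the carries from the top down; so
-- rank T_N = d − 1.  Modulo the carries z_l ≡ t^l z₀, hence the i-th number column is
-- ≡ x_i − N_i z₀.  If N_i ≠ N′_i, the i-th number columns of T_N and T_N′ differ by a vector
-- ≡ (N′_i − N_i) z₀; so z₀, then every z_l, then every x_i lies in the column span of [T_N T_N′].
-- There are t^{mk} ≥ t^{d²/6} choices of N.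

open import Defs

open import Algebra.Bundles using (CommutativeRing)
open import Data.Bool using (true; false; if_then_else_)
open import Data.Empty using (⊥-elim)
open import Data.Fin as Fin using (Fin; zero; suc; toℕ; inject₁; _↑ˡ_; _↑ʳ_; splitAt)
open import Data.Fin.Induction using (<-weakInduction; >-weakInduction)
import Data.Fin.Properties as Fin
open import Data.Integer as ℤ using (ℤ; 0ℤ; 1ℤ)
import Data.Integer.Properties as ℤ
open import Data.List as List using (List; length)
open import Data.List.Membership.Propositional using (_∈_)
open import Data.List.Membership.Propositional.Properties using (∈-tabulate⁻)
import Data.List.Properties as List
open import Data.List.Relation.Unary.Unique.Propositional using (Unique)
open import Data.List.Relation.Unary.Unique.Propositional.Properties using (tabulate⁺)
open import Data.Nat as ℕ using (ℕ; zero; suc; NonZero; _≤_; z≤n; s≤s; _∸_)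
open import Data.Nat.DivMod using (_%_; _/_; m%n<n; m≡m%n+[m/n]*n; m<n*o⇒m/o<n)
import Data.Nat.Properties as ℕ
open import Data.Nat.Tactic.RingSolver using (solve-∀)
open import Data.Product using (Σ; _×_; _,_)
open import Data.Rational as ℚ using (ℚ; 0ℚ; 1ℚ; _+_; _*_; _-_; -_)
open import Data.Rational.Literals using (fromℤ)
import Data.Rational.Properties as ℚ
open import Data.Rational.Solver using (module +-*-Solver)
open +-*-Solver using (solve; _:+_; _:-_; _:*_; :-_; _:=_; con)
open import Algebra.Properties.Group ℚ.+-0-group using (x∙y⁻¹≈ε⇒x≈y)
open import Algebra.Properties.Semiring.Sum (CommutativeRing.semiring ℚ.+-*-commutativeRing)
  using (sum; sum-cong-≗; sum-replicate-zero; ∑-distrib-+; *-distribˡ-sum; *-distribʳ-sum)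
open import Data.Sum using (inj₁; inj₂; [_,_]′)
open import Data.Vec using (lookup; tabulate; zipWith; _++_)
import Data.Vec.Properties as Vec
open import Function using (_∘_)
open import Relation.Binary.PropositionalEquality
open import Relation.Nullary using (¬_; does; yes; no)
open import Relation.Nullary.Decidable using (dec-true; dec-false)

-- Sums and unit vectors over ℚ

Σℚ≡sum : ∀ n (f : Fin n → ℚ) → Σℚ n f ≡ sum f
Σℚ≡sum zero    f = refl
Σℚ≡sum (suc n) f = cong (f zero +_) (Σℚ≡sum n (f ∘ suc))

sum-zero : ∀ {n} {f : Fin n → ℚ} → (∀ j → f j ≡ 0ℚ) → sum f ≡ 0ℚ
sum-zero {n} f≗0 = trans (sum-cong-≗ f≗0) (sum-replicate-zero n)

sum-− : ∀ {n} (f g : Fin n → ℚ) → sum (λ j → f j - g j) ≡ sum f - sum g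
sum-− {zero}  f g = refl
sum-− {suc n} f g = trans (cong (f zero - g zero +_) (sum-− (f ∘ suc) (g ∘ suc)))
  (solve 4 (λ a b c d → (a :- b) :+ (c :- d) := (a :+ c) :- (b :+ d)) refl
     (f zero) (g zero) (sum (f ∘ suc)) (sum (g ∘ suc)))

sum-split : ∀ m {n} (f : Fin (m ℕ.+ n) → ℚ) → sum f ≡ sum (λ i → f (i ↑ˡ n)) + sum (λ j → f (m ↑ʳ j))
sum-split zero    f = sym (ℚ.+-identityˡ (sum f))
sum-split (suc m) f = trans (cong (f zero +_) (sum-split m (f ∘ suc))) (sym (ℚ.+-assoc (f zero) _ _))

e : ∀ {n} → Fin n → Fin n → ℚ
e i j = if does (i Fin.≟ j) then 1ℚ else 0ℚ

e-diag : ∀ {n} (i : Fin n) → e i i ≡ 1ℚ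
e-diag i = cong (if_then 1ℚ else 0ℚ) (dec-true (i Fin.≟ i) refl)

e-≢ : ∀ {n} {i j : Fin n} → i ≢ j → e i j ≡ 0ℚ
e-≢ {i = i} {j} i≢j = cong (if_then 1ℚ else 0ℚ) (dec-false (i Fin.≟ j) i≢j)

e-injective : ∀ {n n′} {f : Fin n → Fin n′} → (∀ {i j} → f i ≡ f j → i ≡ j) →
              ∀ i j → e (f i) (f j) ≡ e i j
e-injective {f = f} f-injective i j with i Fin.≟ j
... | yes refl = e-diag (f i)
... | no i≢j   = e-≢ (i≢j ∘ f-injective)

e-↑ˡ-↑ʳ : ∀ {m n} (i : Fin m) (j : Fin n) → e (i ↑ˡ n) (m ↑ʳ j) ≡ 0ℚ
e-↑ˡ-↑ʳ zero    j = refl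
e-↑ˡ-↑ʳ (suc i) j = e-↑ˡ-↑ʳ i j

e-↑ʳ-↑ˡ : ∀ {m n} (i : Fin m) (j : Fin n) → e (m ↑ʳ j) (i ↑ˡ n) ≡ 0ℚ
e-↑ʳ-↑ˡ zero    j = refl
e-↑ʳ-↑ˡ (suc i) j = e-↑ʳ-↑ˡ i j

sum-e : ∀ {n} (f : Fin n → ℚ) i → sum (λ j → f j * e j i) ≡ f i
sum-e f zero = begin
  f zero * 1ℚ + sum (λ j → f (suc j) * 0ℚ)
    ≡⟨ cong₂ _+_ (ℚ.*-identityʳ (f zero)) (sum-zero (λ j → ℚ.*-zeroʳ (f (suc j)))) ⟩
  f zero + 0ℚ ≡⟨ ℚ.+-identityʳ (f zero) ⟩
  f zero      ∎
  where open ≡-Reasoning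
sum-e f (suc i) = begin
  f zero * 0ℚ + sum (λ j → f (suc j) * e j i) ≡⟨ cong₂ _+_ (ℚ.*-zeroʳ (f zero)) (sum-e (f ∘ suc) i) ⟩
  0ℚ + f (suc i)                              ≡⟨ ℚ.+-identityˡ (f (suc i)) ⟩
  f (suc i)                                   ∎
  where open ≡-Reasoning

data Split (m n : ℕ) : Fin (m ℕ.+ n) → Set where
  left  : (i : Fin m) → Split m n (i ↑ˡ n)
  right : (j : Fin n) → Split m n (m ↑ʳ j)

split : ∀ m {n} (i : Fin (m ℕ.+ n)) → Split m n i
split zero    j       = right j
split (suc m) zero    = left zero
split (suc m) (suc i) with split m i
... | left i′ = left (suc i′)
... | right j = right j

-- Natural numbers as rationals, and base-b digits

fromℕ : ℕ → ℚ
fromℕ n = fromℤ (ℤ.+ n)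

/1≡fromℤ : ∀ z → z ℚ./ 1 ≡ fromℤ z
/1≡fromℤ z = ℚ.↥p/↧p≡p (fromℤ z)

fromℕ-homo-+ : ∀ a b → fromℕ (a ℕ.+ b) ≡ fromℕ a + fromℕ b
fromℕ-homo-+ a b = trans (sym (/1≡fromℤ (ℤ.+ (a ℕ.+ b))))
  (cong₂ (λ x y → (x ℤ.+ y) ℚ./ 1) (sym (ℤ.*-identityʳ (ℤ.+ a))) (sym (ℤ.*-identityʳ (ℤ.+ b))))

fromℕ-homo-* : ∀ a b → fromℕ (a ℕ.* b) ≡ fromℕ a * fromℕ b
fromℕ-homo-* a b = trans (sym (/1≡fromℤ (ℤ.+ (a ℕ.* b)))) (cong (ℚ._/ 1) (ℤ.pos-* a b))

fromℤ-neg : ∀ n → fromℤ (ℤ.- ℤ.+ n) ≡ - fromℕ n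
fromℤ-neg zero    = refl
fromℤ-neg (suc n) = refl

fromℕ-injective : ∀ {a b} → fromℕ a ≡ fromℕ b → a ≡ b
fromℕ-injective eq = ℤ.+-injective (cong ℚ.↥_ eq)

value : ∀ {m} → ℕ → (Fin m → ℕ) → ℚ
value b d = sum (λ l → fromℕ (d l) * fromℕ (b ℕ.^ toℕ l))

value-suc : ∀ b {m} (d : Fin (suc m) → ℕ) → value b d ≡ fromℕ (d zero) + fromℕ b * value b (d ∘ suc)
value-suc b {m} d = cong₂ _+_ (ℚ.*-identityʳ (fromℕ (d zero))) (begin
  sum (λ l → fromℕ (d (suc l)) * fromℕ (b ℕ.* b ℕ.^ toℕ l))
    ≡⟨ sum-cong-≗ {m} shift ⟩
  sum (λ l → fromℕ b * (fromℕ (d (suc l)) * fromℕ (b ℕ.^ toℕ l)))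
    ≡⟨ *-distribˡ-sum (fromℕ b) (λ l → fromℕ (d (suc l)) * fromℕ (b ℕ.^ toℕ l)) ⟨
  fromℕ b * value b (d ∘ suc) ∎)
  where
  open ≡-Reasoning
  shift : ∀ l → fromℕ (d (suc l)) * fromℕ (b ℕ.* b ℕ.^ toℕ l)
              ≡ fromℕ b * (fromℕ (d (suc l)) * fromℕ (b ℕ.^ toℕ l))
  shift l = trans (cong (fromℕ (d (suc l)) *_) (fromℕ-homo-* b (b ℕ.^ toℕ l)))
    (solve 3 (λ a b p → a :* (b :* p) := b :* (a :* p)) refl
       (fromℕ (d (suc l))) (fromℕ b) (fromℕ (b ℕ.^ toℕ l)))

module Digits (b : ℕ) .{{_ : NonZero b}} where

  digit : ∀ {m} → ℕ → Fin m → ℕ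
  digit n zero    = n % b
  digit n (suc l) = digit (n / b) l

  digit<base : ∀ {m} n (l : Fin m) → digit n l ℕ.< b
  digit<base n zero    = m%n<n n b
  digit<base n (suc l) = digit<base (n / b) l

  value-digit : ∀ m n → n ℕ.< b ℕ.^ m → value b (digit {m} n) ≡ fromℕ n
  value-digit zero    n n<1      = cong fromℕ (sym (ℕ.n<1⇒n≡0 n<1))
  value-digit (suc m) n n<b*b^m = begin
    value b (digit {suc m} n)
      ≡⟨ value-suc b {m} (digit n) ⟩
    fromℕ (n % b) + fromℕ b * value b (digit {m} (n / b))
      ≡⟨ cong (λ v → fromℕ (n % b) + fromℕ b * v) (value-digit m (n / b) n/b<b^m) ⟩
    fromℕ (n % b) + fromℕ b * fromℕ (n / b)
      ≡⟨ cong (fromℕ (n % b) +_) (fromℕ-homo-* b (n / b)) ⟨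
    fromℕ (n % b) + fromℕ (b ℕ.* (n / b))
      ≡⟨ fromℕ-homo-+ (n % b) (b ℕ.* (n / b)) ⟨
    fromℕ (n % b ℕ.+ b ℕ.* (n / b))
      ≡⟨ cong (λ q → fromℕ (n % b ℕ.+ q)) (ℕ.*-comm b (n / b)) ⟩
    fromℕ (n % b ℕ.+ n / b ℕ.* b)
      ≡⟨ cong fromℕ (m≡m%n+[m/n]*n n b) ⟨
    fromℕ n ∎
    where
    open ≡-Reasoning
    n/b<b^m : n / b ℕ.< b ℕ.^ m
    n/b<b^m = m<n*o⇒m/o<n (subst (n ℕ.<_) (ℕ.*-comm b (b ℕ.^ m)) n<b*b^m)

-- Column spans

record _∈Span_ {n m} (v : Fin n → ℚ) (M : Mat n m) : Set where
  constructor _,_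
  field
    coefficients : Fin m → ℚ
    combination  : ∀ i → sum (λ j → coefficients j * entry M i j) ≡ v i

module _ {n m} {M : Mat n m} where

  ∈Span-resp-≗ : ∀ {u v} → u ≗ v → u ∈Span M → v ∈Span M
  ∈Span-resp-≗ u≗v (a , Ma≡u) = a , λ i → trans (Ma≡u i) (u≗v i)

  column∈Span : ∀ j → (λ i → entry M i j) ∈Span M
  column∈Span j = (λ j′ → e j′ j) , λ i →
    trans (sum-cong-≗ (λ j′ → ℚ.*-comm (e j′ j) (entry M i j′))) (sum-e (λ j′ → entry M i j′) j)

  0∈Span : (λ _ → 0ℚ) ∈Span M
  0∈Span = (λ _ → 0ℚ) , λ i → sum-zero (λ j → ℚ.*-zeroˡ (entry M i j))

  +-∈Span : ∀ {u v} → u ∈Span M → v ∈Span M → (λ i → u i + v i) ∈Span M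
  +-∈Span {u} {v} (a , Ma≡u) (b , Mb≡v) = (λ j → a j + b j) , λ i → begin
    sum (λ j → (a j + b j) * entry M i j)
      ≡⟨ sum-cong-≗ (λ j → ℚ.*-distribʳ-+ (entry M i j) (a j) (b j)) ⟩
    sum (λ j → a j * entry M i j + b j * entry M i j)
      ≡⟨ ∑-distrib-+ (λ j → a j * entry M i j) (λ j → b j * entry M i j) ⟩
    sum (λ j → a j * entry M i j) + sum (λ j → b j * entry M i j)
      ≡⟨ cong₂ _+_ (Ma≡u i) (Mb≡v i) ⟩
    u i + v i ∎
    where open ≡-Reasoning

  *-∈Span : ∀ q {u} → u ∈Span M → (λ i → q * u i) ∈Span M
  *-∈Span q {u} (a , Ma≡u) = (λ j → q * a j) , λ i → begin
    sum (λ j → q * a j * entry M i j)   ≡⟨ sum-cong-≗ (λ j → ℚ.*-assoc q (a j) (entry M i j)) ⟩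
    sum (λ j → q * (a j * entry M i j)) ≡⟨ *-distribˡ-sum q (λ j → a j * entry M i j) ⟨
    q * sum (λ j → a j * entry M i j)   ≡⟨ cong (q *_) (Ma≡u i) ⟩
    q * u i                             ∎
    where open ≡-Reasoning

  -‿∈Span : ∀ {u v} → u ∈Span M → v ∈Span M → (λ i → u i - v i) ∈Span M
  -‿∈Span {u} {v} u∈ v∈ =
    ∈Span-resp-≗ (λ i → cong (u i +_) (-1*≡neg (v i))) (+-∈Span u∈ (*-∈Span (- 1ℚ) v∈))
    where
    -1*≡neg : ∀ p → - 1ℚ * p ≡ - p
    -1*≡neg p = trans (sym (ℚ.neg-distribˡ-* 1ℚ p)) (cong -_ (ℚ.*-identityˡ p))

  ∑-∈Span : ∀ {k} (a : Fin k → ℚ) {u : Fin k → Fin n → ℚ} →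
            (∀ l → u l ∈Span M) → (λ i → sum (λ l → a l * u l i)) ∈Span M
  ∑-∈Span {zero}  a u∈ = 0∈Span
  ∑-∈Span {suc k} a u∈ = +-∈Span (*-∈Span (a zero) (u∈ zero)) (∑-∈Span (a ∘ suc) (u∈ ∘ suc))

  every∈Span : (∀ j → e j ∈Span M) → ∀ v → v ∈Span M
  every∈Span e∈ v = ∈Span-resp-≗ (sum-e v) (∑-∈Span v e∈)

  columnsSpan : (∀ v → v ∈Span M) → ColumnsSpan M
  columnsSpan every v with every v
  ... | a , Ma≡v = a , λ i → trans (Σℚ≡sum m (λ j → a j * entry M i j)) (Ma≡v i)

entry-∣ˡ : ∀ {n m k} (S : Mat n m) (T : Mat n k) i j → entry [ S ∣ T ] i (j ↑ˡ k) ≡ entry S i j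
entry-∣ˡ S T i j = cong (ℚ._/ 1)
  (trans (cong (λ row → lookup row (j ↑ˡ _)) (Vec.lookup-zipWith _++_ i S T))
         (Vec.lookup-++ˡ (lookup S i) (lookup T i) j))

entry-∣ʳ : ∀ {n m k} (S : Mat n m) (T : Mat n k) i j → entry [ S ∣ T ] i (m ↑ʳ j) ≡ entry T i j
entry-∣ʳ {m = m} S T i j = cong (ℚ._/ 1)
  (trans (cong (λ row → lookup row (m ↑ʳ j)) (Vec.lookup-zipWith _++_ i S T))
         (Vec.lookup-++ʳ (lookup S i) (lookup T i) j))

-- Block matrices and rank

module Block {a b c d : ℕ} (A : Fin a → Fin c → ℤ) (B : Fin a → Fin d → ℤ)
                           (C : Fin b → Fin c → ℤ) (D : Fin b → Fin d → ℤ) where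

  blockEntry : Fin (a ℕ.+ b) → Fin (c ℕ.+ d) → ℤ
  blockEntry r j = [ (λ r → [ A r , B r ]′ (splitAt c j)) , (λ r → [ C r , D r ]′ (splitAt c j)) ]′ (splitAt a r)

  blockMatrix : Mat (a ℕ.+ b) (c ℕ.+ d)
  blockMatrix = tabulate λ r → tabulate (blockEntry r)

  lookup-blockMatrix : ∀ r j → lookup (lookup blockMatrix r) j ≡ blockEntry r j
  lookup-blockMatrix r j =
    trans (cong (λ row → lookup row j) (Vec.lookup∘tabulate _ r)) (Vec.lookup∘tabulate (blockEntry r) j)

  entry-blockMatrix : ∀ r j → entry blockMatrix r j ≡ fromℤ (blockEntry r j)
  entry-blockMatrix r j = trans (cong (ℚ._/ 1) (lookup-blockMatrix r j)) (/1≡fromℤ (blockEntry r j))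

  blockEntry-↑ˡ-↑ˡ : ∀ i j → blockEntry (i ↑ˡ b) (j ↑ˡ d) ≡ A i j
  blockEntry-↑ˡ-↑ˡ i j rewrite Fin.splitAt-↑ˡ a i b | Fin.splitAt-↑ˡ c j d = refl

  blockEntry-↑ˡ-↑ʳ : ∀ i j → blockEntry (i ↑ˡ b) (c ↑ʳ j) ≡ B i j
  blockEntry-↑ˡ-↑ʳ i j rewrite Fin.splitAt-↑ˡ a i b | Fin.splitAt-↑ʳ c d j = refl

  blockEntry-↑ʳ-↑ˡ : ∀ i j → blockEntry (a ↑ʳ i) (j ↑ˡ d) ≡ C i j
  blockEntry-↑ʳ-↑ˡ i j rewrite Fin.splitAt-↑ʳ a b i | Fin.splitAt-↑ˡ c j d = refl

  blockEntry-↑ʳ-↑ʳ : ∀ i j → blockEntry (a ↑ʳ i) (c ↑ʳ j) ≡ D i j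
  blockEntry-↑ʳ-↑ʳ i j rewrite Fin.splitAt-↑ʳ a b i | Fin.splitAt-↑ʳ c d j = refl

  blockMatrix-bounded : ∀ {t} → (∀ i j → ℤ.∣ A i j ∣ ≤ t) → (∀ i j → ℤ.∣ B i j ∣ ≤ t) →
                        (∀ i j → ℤ.∣ C i j ∣ ≤ t) → (∀ i j → ℤ.∣ D i j ∣ ≤ t) →
                        EntriesBounded t blockMatrix
  blockMatrix-bounded A≤ B≤ C≤ D≤ r j rewrite lookup-blockMatrix r j with splitAt a r | splitAt c j
  ... | inj₁ r′ | inj₁ j′ = A≤ r′ j′
  ... | inj₁ r′ | inj₂ j′ = B≤ r′ j′
  ... | inj₂ r′ | inj₁ j′ = C≤ r′ j′
  ... | inj₂ r′ | inj₂ j′ = D≤ r′ j′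

no-rank-beyond-width : ∀ {n m} (M : Mat n m) → ¬ RankAtLeast M (suc m)
no-rank-beyond-width {m = m} M (cols , cols-injective , _) with Fin.pigeonhole (ℕ.n<1+n m) cols
... | i , j , i<j , cols[i]≡cols[j] = Fin.<⇒≢ i<j (cols-injective cols[i]≡cols[j])

independent⇒full-rank : ∀ {n m} (M : Mat n m) → IndependentCols M (λ j → j) → HasRank M m
independent⇒full-rank M independent = ((λ j → j) , (λ eq → eq) , independent) , no-rank-beyond-width M

suc≢inject₁ : ∀ {n} (l : Fin n) → suc l ≢ inject₁ l
suc≢inject₁ (suc l) eq = suc≢inject₁ l (Fin.suc-injective eq)

-- Row l + 1 reads b l = s · b (l + 1), with nothing above the top coefficient, so the
-- coefficients vanish from the top down and s may be anything.
carries-independent : ∀ {n} (s : ℚ) (b : Fin n → ℚ) →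
  (∀ r → sum (λ l → b l * (e (suc l) r - s * e (inject₁ l) r)) ≡ 0ℚ) → ∀ l → b l ≡ 0ℚ
carries-independent {zero}  s b rows≡0 ()
carries-independent {suc n} s b rows≡0 = >-weakInduction (λ l → b l ≡ 0ℚ) top down
  where
  next : Fin (suc n) → ℚ
  next l = sum (λ l′ → b l′ * e (inject₁ l′) (suc l))

  b≡s*next : ∀ l → b l ≡ s * next l
  b≡s*next l = x∙y⁻¹≈ε⇒x≈y (b l) (s * next l) (begin
    b l - s * next l
      ≡⟨ cong₂ _-_ (sum-e b l) (sym (*-distribˡ-sum s (λ l′ → b l′ * e (inject₁ l′) (suc l)))) ⟨
    sum (λ l′ → b l′ * e l′ l) - sum (λ l′ → s * (b l′ * e (inject₁ l′) (suc l)))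
      ≡⟨ sum-− (λ l′ → b l′ * e l′ l) (λ l′ → s * (b l′ * e (inject₁ l′) (suc l))) ⟨
    sum (λ l′ → b l′ * e l′ l - s * (b l′ * e (inject₁ l′) (suc l)))
      ≡⟨ sum-cong-≗ (λ l′ → solve 4 (λ b u s v → b :* u :- s :* (b :* v) := b :* (u :- s :* v)) refl
                                    (b l′) (e l′ l) s (e (inject₁ l′) (suc l))) ⟩
    sum (λ l′ → b l′ * (e (suc l′) (suc l) - s * e (inject₁ l′) (suc l)))
      ≡⟨ rows≡0 (suc l) ⟩
    0ℚ ∎)
    where open ≡-Reasoning

  b≡0 : ∀ {l} → next l ≡ 0ℚ → b l ≡ 0ℚ
  b≡0 {l} next≡0 = trans (b≡s*next l) (trans (cong (s *_) next≡0) (ℚ.*-zeroʳ s))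

  top : b (Fin.fromℕ n) ≡ 0ℚ
  top = b≡0 (sum-zero λ l′ →
    trans (cong (b l′ *_) (e-≢ {i = inject₁ l′} (Fin.fromℕ≢inject₁ ∘ sym))) (ℚ.*-zeroʳ (b l′)))

  down : ∀ i → b (suc i) ≡ 0ℚ → b (inject₁ i) ≡ 0ℚ
  down i b[i+1]≡0 = b≡0 (begin
    sum (λ l′ → b l′ * e (inject₁ l′) (inject₁ (suc i)))
      ≡⟨ sum-cong-≗ (λ l′ → cong (b l′ *_) (e-injective Fin.inject₁-injective l′ (suc i))) ⟩
    sum (λ l′ → b l′ * e l′ (suc i)) ≡⟨ sum-e b (suc i) ⟩
    b (suc i)                        ≡⟨ b[i+1]≡0 ⟩
    0ℚ                               ∎)
    where open ≡-Reasoning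

module Construction (t : ℕ) {m′ k : ℕ} where

  place : Fin (suc m′) → Fin (suc m′ ℕ.+ k)
  place l = l ↑ˡ k

  slot : Fin k → Fin (suc m′ ℕ.+ k)
  slot i = suc m′ ↑ʳ i

  carry : Fin m′ → Fin (m′ ℕ.+ k)
  carry l = l ↑ˡ k

  number : Fin k → Fin (m′ ℕ.+ k)
  number i = m′ ↑ʳ i

  carryBlock : Fin (suc m′) → Fin m′ → ℤ
  carryBlock r l = if does (suc l Fin.≟ r) then 1ℤ else if does (inject₁ l Fin.≟ r) then ℤ.- ℤ.+ t else 0ℤ

  unitBlock : Fin k → Fin k → ℤ
  unitBlock j i = if does (i Fin.≟ j) then 1ℤ else 0ℤ

  e-place : ∀ l l′ → e (place l) (place l′) ≡ e l l′
  e-place = e-injective (Fin.↑ˡ-injective k _ _)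

  e-slot : ∀ i j → e (slot i) (slot j) ≡ e i j
  e-slot = e-injective (Fin.↑ʳ-injective (suc m′) _ _)

  digitVector : (Fin (suc m′) → ℕ) → Fin (suc m′ ℕ.+ k) → ℚ
  digitVector d r = sum (λ l → fromℕ (d l) * e (place l) r)

  power : Fin (suc m′) → ℚ
  power l = fromℕ (t ℕ.^ toℕ l)

  power-suc : ∀ l → power (suc l) ≡ fromℕ t * power (inject₁ l)
  power-suc l = trans (fromℕ-homo-* t (t ℕ.^ toℕ l))
                      (cong (λ n → fromℕ t * fromℕ (t ℕ.^ n)) (sym (Fin.toℕ-inject₁ l)))

  module _ (c : Fin k → Fin (suc m′) → ℕ) where

    digitBlock : Fin (suc m′) → Fin k → ℤ
    digitBlock l i = ℤ.- ℤ.+ c i l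

    open Block carryBlock digitBlock (λ _ _ → 0ℤ) unitBlock

    matrix : Mat (suc m′ ℕ.+ k) (m′ ℕ.+ k)
    matrix = blockMatrix

    entry-place-carry : ∀ r l → entry matrix (place r) (carry l) ≡ e (suc l) r - fromℕ t * e (inject₁ l) r
    entry-place-carry r l =
      trans (entry-blockMatrix (place r) (carry l)) (trans (cong fromℤ (blockEntry-↑ˡ-↑ˡ r l)) fromℤ-carryBlock)
      where
      fromℤ-carryBlock : fromℤ (carryBlock r l) ≡ e (suc l) r - fromℕ t * e (inject₁ l) r
      fromℤ-carryBlock with suc l Fin.≟ r | inject₁ l Fin.≟ r
      ... | yes refl | yes eq = ⊥-elim (suc≢inject₁ l (sym eq))
      ... | yes _    | no _   = sym (cong (λ y → 1ℚ - y) (ℚ.*-zeroʳ (fromℕ t)))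
      ... | no _     | yes _  = trans (fromℤ-neg t) (solve 1 (λ t → :- t := con 0ℚ :- t :* con 1ℚ) refl (fromℕ t))
      ... | no _     | no _   = sym (cong (λ y → 0ℚ - y) (ℚ.*-zeroʳ (fromℕ t)))

    entry-place-number : ∀ l i → entry matrix (place l) (number i) ≡ - fromℕ (c i l)
    entry-place-number l i =
      trans (entry-blockMatrix (place l) (number i)) (trans (cong fromℤ (blockEntry-↑ˡ-↑ʳ l i)) (fromℤ-neg (c i l)))

    entry-slot-carry : ∀ j l → entry matrix (slot j) (carry l) ≡ 0ℚ
    entry-slot-carry j l = trans (entry-blockMatrix (slot j) (carry l)) (cong fromℤ (blockEntry-↑ʳ-↑ˡ j l))

    entry-slot-number : ∀ j i → entry matrix (slot j) (number i) ≡ e i j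
    entry-slot-number j i =
      trans (entry-blockMatrix (slot j) (number i)) (trans (cong fromℤ (blockEntry-↑ʳ-↑ʳ j i)) fromℤ-unitBlock)
      where
      fromℤ-unitBlock : fromℤ (unitBlock j i) ≡ e i j
      fromℤ-unitBlock with does (i Fin.≟ j)
      ... | true  = refl
      ... | false = refl

    matrix-bounded : 1 ≤ t → (∀ i l → c i l ≤ t) → EntriesBounded t matrix
    matrix-bounded 1≤t c≤t = blockMatrix-bounded carry≤t digit≤t (λ _ _ → z≤n) unit≤t
      where
      carry≤t : ∀ r l → ℤ.∣ carryBlock r l ∣ ≤ t
      carry≤t r l with does (suc l Fin.≟ r) | does (inject₁ l Fin.≟ r)
      ... | true  | _     = 1≤t
      ... | false | true  = ℕ.≤-reflexive (ℤ.∣-i∣≡∣i∣ (ℤ.+ t))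
      ... | false | false = z≤n

      digit≤t : ∀ l i → ℤ.∣ digitBlock l i ∣ ≤ t
      digit≤t l i = ℕ.≤-trans (ℕ.≤-reflexive (ℤ.∣-i∣≡∣i∣ (ℤ.+ c i l))) (c≤t i l)

      unit≤t : ∀ j i → ℤ.∣ unitBlock j i ∣ ≤ t
      unit≤t j i with does (i Fin.≟ j)
      ... | true  = 1≤t
      ... | false = z≤n

    carry-column : ∀ l r → entry matrix r (carry l) ≡ e (place (suc l)) r - fromℕ t * e (place (inject₁ l)) r
    carry-column l r with split (suc m′) r
    ... | left r′ = trans (entry-place-carry r′ l)
      (sym (cong₂ (λ u v → u - fromℕ t * v) (e-place (suc l) r′) (e-place (inject₁ l) r′)))
    ... | right j = trans (entry-slot-carry j l) (sym (begin
      e (place (suc l)) (slot j) - fromℕ t * e (place (inject₁ l)) (slot j)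
        ≡⟨ cong₂ (λ u v → u - fromℕ t * v) (e-↑ˡ-↑ʳ (suc l) j) (e-↑ˡ-↑ʳ (inject₁ l) j) ⟩
      0ℚ - fromℕ t * 0ℚ ≡⟨ cong (λ y → 0ℚ - y) (ℚ.*-zeroʳ (fromℕ t)) ⟩
      0ℚ                ∎))
      where open ≡-Reasoning

    number-column : ∀ i r → entry matrix r (number i) ≡ e (slot i) r - digitVector (c i) r
    number-column i r with split (suc m′) r
    ... | left l = trans (entry-place-number l i) (sym (begin
      e (slot i) (place l) - sum (λ l′ → fromℕ (c i l′) * e (place l′) (place l))
        ≡⟨ cong₂ _-_ (e-↑ʳ-↑ˡ l i) (sum-cong-≗ (λ l′ → cong (fromℕ (c i l′) *_) (e-place l′ l))) ⟩
      0ℚ - sum (λ l′ → fromℕ (c i l′) * e l′ l) ≡⟨ cong (λ y → 0ℚ - y) (sum-e (fromℕ ∘ c i) l) ⟩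
      0ℚ - fromℕ (c i l)                       ≡⟨ ℚ.+-identityˡ (- fromℕ (c i l)) ⟩
      - fromℕ (c i l)                          ∎))
      where open ≡-Reasoning
    ... | right j = trans (entry-slot-number j i) (sym (begin
      e (slot i) (slot j) - sum (λ l′ → fromℕ (c i l′) * e (place l′) (slot j))
        ≡⟨ cong₂ _-_ (e-slot i j)
                     (sum-zero (λ l′ → trans (cong (fromℕ (c i l′) *_) (e-↑ˡ-↑ʳ l′ j))
                                             (ℚ.*-zeroʳ (fromℕ (c i l′))))) ⟩
      e i j - 0ℚ ≡⟨ ℚ.+-identityʳ (e i j) ⟩
      e i j      ∎))
      where open ≡-Reasoning

    matrix-independent : IndependentCols matrix (λ j → j)
    matrix-independent a Ma≡0 = coefficient≡0
      where
      row≡0 : ∀ r → sum (λ l → a (carry l) * entry matrix r (carry l))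
                    + sum (λ i → a (number i) * entry matrix r (number i)) ≡ 0ℚ
      row≡0 r = trans (sym (sum-split m′ (λ j → a j * entry matrix r j)))
                      (trans (sym (Σℚ≡sum (m′ ℕ.+ k) (λ j → a j * entry matrix r j))) (Ma≡0 r))

      number-coefficient≡0 : ∀ j → a (number j) ≡ 0ℚ
      number-coefficient≡0 j = begin
        a (number j)                          ≡⟨ sum-e (a ∘ number) j ⟨
        sum (λ i → a (number i) * e i j)      ≡⟨ ℚ.+-identityˡ _ ⟨
        0ℚ + sum (λ i → a (number i) * e i j)
          ≡⟨ cong₂ _+_ (sym (sum-zero (λ l → trans (cong (a (carry l) *_) (entry-slot-carry j l))
                                                   (ℚ.*-zeroʳ (a (carry l))))))
                       (sum-cong-≗ (λ i → cong (a (number i) *_) (sym (entry-slot-number j i)))) ⟩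
        sum (λ l → a (carry l) * entry matrix (slot j) (carry l))
          + sum (λ i → a (number i) * entry matrix (slot j) (number i)) ≡⟨ row≡0 (slot j) ⟩
        0ℚ ∎
        where open ≡-Reasoning

      carry-coefficient≡0 : ∀ l → a (carry l) ≡ 0ℚ
      carry-coefficient≡0 = carries-independent (fromℕ t) (a ∘ carry) λ r → begin
        sum (λ l → a (carry l) * (e (suc l) r - fromℕ t * e (inject₁ l) r))      ≡⟨ ℚ.+-identityʳ _ ⟨
        sum (λ l → a (carry l) * (e (suc l) r - fromℕ t * e (inject₁ l) r)) + 0ℚ
          ≡⟨ cong₂ _+_ (sum-cong-≗ (λ l → cong (a (carry l) *_) (sym (entry-place-carry r l))))
                       (sym (sum-zero (λ i → trans (cong (_* entry matrix (place r) (number i))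
                                                         (number-coefficient≡0 i))
                                                   (ℚ.*-zeroˡ (entry matrix (place r) (number i)))))) ⟩
        sum (λ l → a (carry l) * entry matrix (place r) (carry l))
          + sum (λ i → a (number i) * entry matrix (place r) (number i)) ≡⟨ row≡0 (place r) ⟩
        0ℚ ∎
        where open ≡-Reasoning

      coefficient≡0 : ∀ j → a j ≡ 0ℚ
      coefficient≡0 j with split m′ j
      ... | left l  = carry-coefficient≡0 l
      ... | right i = number-coefficient≡0 i

    matrix-rank : HasRank matrix (m′ ℕ.+ k)
    matrix-rank = independent⇒full-rank matrix matrix-independent

  matrix-injective : ∀ {c c′} → matrix c ≡ matrix c′ → ∀ i l → c i l ≡ c′ i l
  matrix-injective {c} {c′} Mc≡Mc′ i l = fromℕ-injective (ℚ.neg-injective (begin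
    - fromℕ (c i l)                        ≡⟨ entry-place-number c l i ⟨
    entry (matrix c) (place l) (number i)  ≡⟨ cong (λ M → entry M (place l) (number i)) Mc≡Mc′ ⟩
    entry (matrix c′) (place l) (number i) ≡⟨ entry-place-number c′ l i ⟩
    - fromℕ (c′ i l)                       ∎))
    where open ≡-Reasoning

  module Spanning (c c′ : Fin k → Fin (suc m′) → ℕ) (i₀ : Fin k)
                  (values-differ : value t (c i₀) ≢ value t (c′ i₀)) where

    M : Mat (suc m′ ℕ.+ k) ((m′ ℕ.+ k) ℕ.+ (m′ ℕ.+ k))
    M = [ matrix c ∣ matrix c′ ]

    left∈Span : ∀ j → (λ r → entry (matrix c) r j) ∈Span M
    left∈Span j =
      ∈Span-resp-≗ (λ r → entry-∣ˡ (matrix c) (matrix c′) r j) (column∈Span (j ↑ˡ (m′ ℕ.+ k)))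

    right∈Span : ∀ j → (λ r → entry (matrix c′) r j) ∈Span M
    right∈Span j =
      ∈Span-resp-≗ (λ r → entry-∣ʳ (matrix c) (matrix c′) r j) (column∈Span ((m′ ℕ.+ k) ↑ʳ j))

    place−power∈Span : ∀ l → (λ r → e (place l) r - power l * e (place zero) r) ∈Span M
    place−power∈Span =
      <-weakInduction (λ l → (λ r → e (place l) r - power l * e (place zero) r) ∈Span M) base step
      where
      base : (λ r → e (place zero) r - 1ℚ * e (place zero) r) ∈Span M
      base = ∈Span-resp-≗ (λ r → solve 1 (λ z → con 0ℚ := z :- con 1ℚ :* z) refl (e (place zero) r)) 0∈Span

      step : ∀ i → (λ r → e (place (inject₁ i)) r - power (inject₁ i) * e (place zero) r) ∈Span M →
                   (λ r → e (place (suc i)) r - power (suc i) * e (place zero) r) ∈Span M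
      step i place−power∈ = ∈Span-resp-≗ telescope
        (+-∈Span (∈Span-resp-≗ (carry-column c i) (left∈Span (carry i))) (*-∈Span (fromℕ t) place−power∈))
        where
        telescope : ∀ r → (e (place (suc i)) r - fromℕ t * e (place (inject₁ i)) r)
                          + fromℕ t * (e (place (inject₁ i)) r - power (inject₁ i) * e (place zero) r)
                        ≡ e (place (suc i)) r - power (suc i) * e (place zero) r
        telescope r = trans
          (solve 5 (λ a t b w z → (a :- t :* b) :+ t :* (b :- w :* z) := a :- (t :* w) :* z) refl
             (e (place (suc i)) r) (fromℕ t) (e (place (inject₁ i)) r) (power (inject₁ i)) (e (place zero) r))
          (cong (λ w → e (place (suc i)) r - w * e (place zero) r) (sym (power-suc i)))

    digitVector−value∈Span : ∀ d → (λ r → digitVector d r - value t d * e (place zero) r) ∈Span M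
    digitVector−value∈Span d = ∈Span-resp-≗ collect (∑-∈Span (fromℕ ∘ d) place−power∈Span)
      where
      collect : ∀ r → sum (λ l → fromℕ (d l) * (e (place l) r - power l * e (place zero) r))
                      ≡ digitVector d r - value t d * e (place zero) r
      collect r = begin
        sum (λ l → fromℕ (d l) * (e (place l) r - power l * e (place zero) r))
          ≡⟨ sum-cong-≗ (λ l → solve 4 (λ a u w z → a :* (u :- w :* z) := a :* u :- (a :* w) :* z) refl
                                   (fromℕ (d l)) (e (place l) r) (power l) (e (place zero) r)) ⟩
        sum (λ l → fromℕ (d l) * e (place l) r - fromℕ (d l) * power l * e (place zero) r)
          ≡⟨ sum-− (λ l → fromℕ (d l) * e (place l) r) (λ l → fromℕ (d l) * power l * e (place zero) r) ⟩
        digitVector d r - sum (λ l → fromℕ (d l) * power l * e (place zero) r)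
          ≡⟨ cong (λ y → digitVector d r - y) (*-distribʳ-sum (e (place zero) r) (λ l → fromℕ (d l) * power l)) ⟨
        digitVector d r - value t d * e (place zero) r ∎
        where open ≡-Reasoning

    place-zero∈Span : e (place zero) ∈Span M
    place-zero∈Span = ∈Span-resp-≗ cancel (*-∈Span (ℚ.1/ gap) gap*place-zero∈Span)
      where
      gap : ℚ
      gap = value t (c′ i₀) - value t (c i₀)

      instance
        gap≢0 : ℚ.NonZero gap
        gap≢0 = ℚ.≢-nonZero (values-differ ∘ sym ∘ x∙y⁻¹≈ε⇒x≈y (value t (c′ i₀)) (value t (c i₀)))

      gap*place-zero∈Span : (λ r → gap * e (place zero) r) ∈Span M
      gap*place-zero∈Span = ∈Span-resp-≗ difference
        (+-∈Span (-‿∈Span (-‿∈Span (left∈Span (number i₀)) (right∈Span (number i₀)))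
                            (digitVector−value∈Span (c′ i₀)))
                 (digitVector−value∈Span (c i₀)))
        where
        difference : ∀ r → (entry (matrix c) r (number i₀) - entry (matrix c′) r (number i₀)
                             - (digitVector (c′ i₀) r - value t (c′ i₀) * e (place zero) r))
                           + (digitVector (c i₀) r - value t (c i₀) * e (place zero) r)
                         ≡ gap * e (place zero) r
        difference r rewrite number-column c i₀ r | number-column c′ i₀ r =
          solve 6 (λ x d d′ v v′ z → (((x :- d) :- (x :- d′)) :- (d′ :- v′ :* z)) :+ (d :- v :* z)
                                       := (v′ :- v) :* z) refl
            (e (slot i₀) r) (digitVector (c i₀) r) (digitVector (c′ i₀) r)
            (value t (c i₀)) (value t (c′ i₀)) (e (place zero) r)

      cancel : ∀ r → ℚ.1/ gap * (gap * e (place zero) r) ≡ e (place zero) r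
      cancel r = begin
        ℚ.1/ gap * (gap * e (place zero) r) ≡⟨ ℚ.*-assoc (ℚ.1/ gap) gap (e (place zero) r) ⟨
        ℚ.1/ gap * gap * e (place zero) r   ≡⟨ cong (_* e (place zero) r) (ℚ.*-inverseˡ gap) ⟩
        1ℚ * e (place zero) r               ≡⟨ ℚ.*-identityˡ (e (place zero) r) ⟩
        e (place zero) r                    ∎
        where open ≡-Reasoning

    place∈Span : ∀ l → e (place l) ∈Span M
    place∈Span l = ∈Span-resp-≗
      (λ r → solve 3 (λ u w z → (u :- w :* z) :+ w :* z := u) refl (e (place l) r) (power l) (e (place zero) r))
      (+-∈Span (place−power∈Span l) (*-∈Span (power l) place-zero∈Span))

    slot∈Span : ∀ i → e (slot i) ∈Span M
    slot∈Span i = ∈Span-resp-≗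
      (λ r → trans (cong (_+ digitVector (c i) r) (number-column c i r))
                   (solve 2 (λ x d → (x :- d) :+ d := x) refl (e (slot i) r) (digitVector (c i) r)))
      (+-∈Span (left∈Span (number i)) (∑-∈Span (fromℕ ∘ c i) place∈Span))

    unit∈Span : ∀ r → e r ∈Span M
    unit∈Span r with split (suc m′) r
    ... | left l  = place∈Span l
    ... | right i = slot∈Span i

    spans : ColumnsSpan M
    spans = columnsSpan (every∈Span unit∈Span)

funToFin-cong : ∀ {m n} {f g : Fin m → Fin n} → f ≗ g → Fin.funToFin f ≡ Fin.funToFin g
funToFin-cong {zero}  f≗g = refl
funToFin-cong {suc m} f≗g = cong₂ Fin.combine (f≗g zero) (funToFin-cong (f≗g ∘ suc))

finToFun-injective : ∀ {m n} {x y : Fin (m ℕ.^ n)} → Fin.finToFun {m} {n} x ≗ Fin.finToFun y → x ≡ y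
finToFun-injective {m} {n} {x} {y} x≗y = begin
  x                                    ≡⟨ Fin.funToFin-finToFin {n} {m} x ⟨
  Fin.funToFin (Fin.finToFun {m} {n} x) ≡⟨ funToFin-cong {n} {m} x≗y ⟩
  Fin.funToFin (Fin.finToFun {m} {n} y) ≡⟨ Fin.funToFin-finToFin {n} {m} y ⟩
  y                                    ∎
  where open ≡-Reasoning

halves : ∀ e → Σ ℕ λ m′ → Σ ℕ λ k → e ≡ m′ ℕ.+ k × m′ ≤ k × k ≤ suc m′
halves zero = 0 , 0 , refl , z≤n , z≤n
halves (suc e) with halves e
... | m′ , k , e≡m′+k , m′≤k , k≤1+m′ =
  k , suc m′ , trans (cong suc (trans e≡m′+k (ℕ.+-comm m′ k))) (sym (ℕ.+-suc k m′)) , k≤1+m′ , s≤s m′≤k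

larger-half-positive : ∀ {m′ k} → m′ ≤ k → 1 ≤ m′ ℕ.+ k → 1 ≤ k
larger-half-positive {k = zero}  z≤n ()
larger-half-positive {k = suc k} _   _ = s≤s z≤n

square≤6*product : ∀ {m′ k} → m′ ≤ k → k ≤ suc m′ → 1 ≤ k →
                   (suc m′ ℕ.+ k) ℕ.* (suc m′ ℕ.+ k) ≤ suc m′ ℕ.* k ℕ.* 6
square≤6*product {m′} {k@(suc k′)} m′≤k k≤1+m′ _ = begin
  (suc m′ ℕ.+ k) ℕ.* (suc m′ ℕ.+ k)       ≤⟨ ℕ.*-mono-≤ d≤2m d≤3k ⟩
  (suc m′ ℕ.+ suc m′) ℕ.* (k ℕ.+ k ℕ.+ k) ≡⟨ rearrange (suc m′) k ⟩
  suc m′ ℕ.* k ℕ.* 6                       ∎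
  where
  open ℕ.≤-Reasoning
  d≤2m : suc m′ ℕ.+ k ≤ suc m′ ℕ.+ suc m′
  d≤2m = ℕ.+-monoʳ-≤ (suc m′) k≤1+m′
  d≤3k : suc m′ ℕ.+ k ≤ k ℕ.+ k ℕ.+ k
  d≤3k = ℕ.+-monoˡ-≤ k (s≤s (ℕ.≤-trans m′≤k (ℕ.m≤n+m k k′)))
  rearrange : ∀ a b → (a ℕ.+ a) ℕ.* (b ℕ.+ b ℕ.+ b) ≡ a ℕ.* b ℕ.* 6
  rearrange = solve-∀

SpanningFamily : ℕ → ℕ → ℕ → ℕ → Set
SpanningFamily p q d t = Σ (List (Mat d (d ∸ 1))) λ 𝒯 →
    Unique 𝒯
    × t ℕ.^ (p ℕ.* (d ℕ.* d)) ≤ length 𝒯 ℕ.^ q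
    × (∀ {T} → T ∈ 𝒯 → EntriesBounded t T)
    × (∀ {T} → T ∈ 𝒯 → HasRank T (d ∸ 1))
    × (∀ {S T} → S ∈ 𝒯 → T ∈ 𝒯 → S ≢ T → ColumnsSpan [ S ∣ T ])

module Family (t₁ m′ k : ℕ) where

  t : ℕ
  t = suc t₁

  open Construction t {m′} {k}
  open Digits t

  digitsOf : Fin ((t ℕ.^ suc m′) ℕ.^ k) → Fin k → Fin (suc m′) → ℕ
  digitsOf r i = digit (toℕ (Fin.finToFun r i))

  value-digitsOf : ∀ r i → value t (digitsOf r i) ≡ fromℕ (toℕ (Fin.finToFun r i))
  value-digitsOf r i = value-digit (suc m′) (toℕ (Fin.finToFun r i)) (Fin.toℕ<n (Fin.finToFun r i))

  member : Fin ((t ℕ.^ suc m′) ℕ.^ k) → Mat (suc m′ ℕ.+ k) (m′ ℕ.+ k)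
  member r = matrix (digitsOf r)

  member-injective : ∀ {r r′} → member r ≡ member r′ → r ≡ r′
  member-injective {r} {r′} Mr≡Mr′ = finToFun-injective {t ℕ.^ suc m′} {k} λ i →
    Fin.toℕ-injective (fromℕ-injective (begin
      fromℕ (toℕ (Fin.finToFun r i))  ≡⟨ value-digitsOf r i ⟨
      value t (digitsOf r i)
        ≡⟨ sum-cong-≗ (λ l → cong (λ n → fromℕ n * power l) (matrix-injective Mr≡Mr′ i l)) ⟩
      value t (digitsOf r′ i)         ≡⟨ value-digitsOf r′ i ⟩
      fromℕ (toℕ (Fin.finToFun r′ i)) ∎))
    where open ≡-Reasoning

  distinct-members-span : ∀ {r r′} → member r ≢ member r′ → ColumnsSpan [ member r ∣ member r′ ]
  distinct-members-span {r} {r′} Mr≢Mr′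
    with Fin.¬∀⟶∃¬ k (λ i → Fin.finToFun r i ≡ Fin.finToFun r′ i)
                     (λ i → Fin.finToFun r i Fin.≟ Fin.finToFun r′ i)
                     (Mr≢Mr′ ∘ cong member ∘ finToFun-injective {t ℕ.^ suc m′} {k})
  ... | i₀ , numbers-differ = Spanning.spans (digitsOf r) (digitsOf r′) i₀ values-differ
    where
    values-differ : value t (digitsOf r i₀) ≢ value t (digitsOf r′ i₀)
    values-differ eq = numbers-differ (Fin.toℕ-injective (fromℕ-injective
      (trans (sym (value-digitsOf r i₀)) (trans eq (value-digitsOf r′ i₀)))))

  spanningFamily : m′ ≤ k → k ≤ suc m′ → 1 ≤ k → SpanningFamily 1 6 (suc m′ ℕ.+ k) t
  spanningFamily m′≤k k≤1+m′ 1≤k = family , tabulate⁺ member-injective , size , bounded , rank , spans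
    where
    family : List (Mat (suc m′ ℕ.+ k) (m′ ℕ.+ k))
    family = List.tabulate member

    size : t ℕ.^ (1 ℕ.* ((suc m′ ℕ.+ k) ℕ.* (suc m′ ℕ.+ k))) ≤ length family ℕ.^ 6
    size = begin
      t ℕ.^ (1 ℕ.* ((suc m′ ℕ.+ k) ℕ.* (suc m′ ℕ.+ k)))
        ≡⟨ cong (t ℕ.^_) (ℕ.*-identityˡ ((suc m′ ℕ.+ k) ℕ.* (suc m′ ℕ.+ k))) ⟩
      t ℕ.^ ((suc m′ ℕ.+ k) ℕ.* (suc m′ ℕ.+ k))
        ≤⟨ ℕ.^-monoʳ-≤ t (square≤6*product m′≤k k≤1+m′ 1≤k) ⟩
      t ℕ.^ (suc m′ ℕ.* k ℕ.* 6)
        ≡⟨ trans (cong (ℕ._^ 6) (ℕ.^-*-assoc t (suc m′) k)) (ℕ.^-*-assoc t (suc m′ ℕ.* k) 6) ⟨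
      ((t ℕ.^ suc m′) ℕ.^ k) ℕ.^ 6
        ≡⟨ cong (ℕ._^ 6) (List.length-tabulate member) ⟨
      length family ℕ.^ 6 ∎
      where open ℕ.≤-Reasoning

    bounded : ∀ {T} → T ∈ family → EntriesBounded t T
    bounded T∈ with ∈-tabulate⁻ T∈
    ... | r , refl =
      matrix-bounded (digitsOf r) (s≤s z≤n) (λ i l → ℕ.<⇒≤ (digit<base (toℕ (Fin.finToFun r i)) l))

    rank : ∀ {T} → T ∈ family → HasRank T (m′ ℕ.+ k)
    rank T∈ with ∈-tabulate⁻ T∈
    ... | r , refl = matrix-rank (digitsOf r)

    spans : ∀ {S T} → S ∈ family → T ∈ family → S ≢ T → ColumnsSpan [ S ∣ T ]
    spans S∈ T∈ with ∈-tabulate⁻ S∈ | ∈-tabulate⁻ T∈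
    ... | r , refl | r′ , refl = distinct-members-span

spanningFamily : ∀ d t → 2 ≤ d → 1 ≤ t → SpanningFamily 1 6 d t
spanningFamily (suc e) (suc t₁) (s≤s 1≤e) _ with halves e
... | m′ , k , refl , m′≤k , k≤1+m′ =
  Family.spanningFamily t₁ m′ k m′≤k k≤1+m′ (larger-half-positive m′≤k 1≤e)

lemma3p3 : Σ ℕ λ p → Σ ℕ λ q → 0 ℕ.< p × 0 ℕ.< q × Σ ℕ λ d₀ →
    ∀ (d : ℕ) → 0 ℕ.< d → d₀ ≤ d →
    Σ ℕ λ t₀ → ∀ (t : ℕ) → t₀ ≤ t →
    Σ (List (Mat d (d ∸ 1))) λ 𝒯 →
      Unique 𝒯
      × t ℕ.^ (p ℕ.* (d ℕ.* d)) ≤ length 𝒯 ℕ.^ q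
      × (∀ {T} → T ∈ 𝒯 → EntriesBounded t T)
      × (∀ {T} → T ∈ 𝒯 → HasRank T (d ∸ 1))
      × (∀ {S T} → S ∈ 𝒯 → T ∈ 𝒯 → S ≢ T → ColumnsSpan [ S ∣ T ])
lemma3p3 = 1 , 6 , s≤s z≤n , s≤s z≤n , 2 , λ d _ 2≤d → 1 , λ t 1≤t → spanningFamily d t 2≤d 1≤t
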